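{- Let $i=i_0i_1i_2\cdots$ be an interaction sequence and $I$ be a union of isolated intervals. Then $I$ is isolated and $i-I$ is either empty or an interaction sequence.
   Context: A pointer sequence is a sequence of natural numbers $i_0i_1i_2\cdots$ with $i_0=0$ and $i_{n+1}<n+1$ for every $n$. An interaction sequence is a pointer sequence such that $i_{n+1}\in V(n+1)=\{n\}\cup V(i_n)$, where $V(0)=\emptyset$. For a pointer sequence $i$, a set $I\subseteq\mathrm{dom}(i)=\{0,1,\ldots\}$ is isolated if $i_n\in I$ implies $n\in I$ for all $n$. An interval of $i$ is a set of the form $[i_m,m]$. $i-I$ is the empty sequence if $I=\{0,1,\ldots\}$, and otherwise the unique pointer sequence $j$ such that $i_{e(n)}=e(j_n)$, where $e(0)<e(1)<\cdots$ enumerates $\{0,1,\ldots\}\setminus I$. -}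

module Defs where

open import Data.Nat using (ℕ; zero; suc; _≤_; _<_)
open import Data.Maybe using (Maybe; just; nothing)
open import Data.Product using (Σ; _×_; ∃)
open import Data.Sum using (_⊎_)
open import Relation.Nullary using (¬_)
open import Relation.Binary.PropositionalEquality using (_≡_)

-- A (finite or infinite) sequence of naturals: s n ≡ just k means the
-- n-th entry is k; s n ≡ nothing means n is outside the domain.
Seq : Set
Seq = ℕ → Maybe ℕ

Dom : Seq → ℕ → Set
Dom s n = Σ ℕ λ k → s n ≡ just k

Subset : Set₁
Subset = ℕ → Set

record PointerSeq (s : Seq) : Set where
  field
    down   : ∀ n → Dom s (suc n) → Dom s n
    start  : s 0 ≡ just 0
    points : ∀ n k → s (suc n) ≡ just k → k < suc n

-- V(m) for a sequence s, as the least sets with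
--   V(0) = ∅,  V(n+1) = {n} ∪ V(i_n).
data V (s : Seq) : ℕ → ℕ → Set where
  here  : ∀ {n} → V s (suc n) n
  there : ∀ {n k x} → s n ≡ just k → V s k x → V s (suc n) x

record Interaction (s : Seq) : Set where
  field
    pointer : PointerSeq s
    inV     : ∀ n k → s (suc n) ≡ just k → V s (suc n) k

Isolated : Seq → Subset → Set
Isolated s I = (∀ n → I n → Dom s n) × (∀ n k → s n ≡ just k → I k → I n)

Interval : Seq → ℕ → Subset
Interval s m x = Σ ℕ λ k → s m ≡ just k × k ≤ x × x ≤ m

UnionOfIsolatedIntervals : Seq → Subset → Set₁
UnionOfIsolatedIntervals s I =
  Σ Subset λ M →
    (∀ m → M m → Dom s m × Isolated s (Interval s m)) ×
    (∀ x → I x → Σ ℕ λ m → M m × Interval s m x) ×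
    (∀ x m → M m → Interval s m x → I x)

MinusEmpty : Seq → Subset → Set
MinusEmpty s I = ∀ n → Dom s n → I n

-- t is i - I (non-empty case): t is a pointer sequence and there is
-- e with e(0) < e(1) < ⋯ (indexed by dom(t)) enumerating dom(i) ∖ I,
-- such that i_{e(n)} = e(t_n).
IsMinus : Seq → Subset → Seq → Set
IsMinus s I t =
  PointerSeq t ×
  Σ (ℕ → ℕ) λ e →
    (∀ m n → Dom t n → m < n → e m < e n) ×
    (∀ n → Dom t n → Dom s (e n) × ¬ I (e n)) ×
    (∀ x → Dom s x → ¬ I x → Σ ℕ λ n → Dom t n × e n ≡ x) ×
    (∀ n k → t n ≡ just k → s (e n) ≡ just (e k))

-- The elements of dom(i) ∖ I are kept and renumbered by their rank (the
-- number of kept elements before them); i - I sends rank x to rank i_x.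
-- Since I is isolated, kept elements point to kept elements, so this is a
-- pointer sequence enumerated by the inverse of the rank.  For the
-- interaction property, follow a chain x > i_{x-1} > ⋯ witnessing a ∈ V(x):
-- a link leaving a kept element is mirrored in i - I, and a run of links
-- through I stays inside the isolated intervals covering the gap below the
-- last kept element, because two isolated intervals cannot cross.
module Submission where

open import Defs
open import Level using (0ℓ)
open import Axiom.ExcludedMiddle using (ExcludedMiddle)
open import Data.Product using (Σ; _×_; _,_; proj₁; proj₂)
open import Data.Sum using (_⊎_; inj₁; inj₂)
open import Data.Nat using (ℕ; zero; suc; _≤_; _<_; z≤n; s≤s; z<s; _≤?_)
open import Data.Nat.Properties
open import Data.Maybe as Maybe using (just; nothing)
open import Data.Maybe.Properties using (just-injective)
open import Data.Empty using (⊥; ⊥-elim)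
open import Relation.Nullary using (¬_; yes; no; contradiction)
open import Relation.Binary.PropositionalEquality
open import Relation.Binary.Definitions using (tri<; tri≈; tri>)

dom-downward : ∀ {s m n} → PointerSeq s → Dom s n → m ≤ n → Dom s m
dom-downward {n = zero} ptr d z≤n = d
dom-downward {n = suc n} ptr d m≤1+n with m≤n⇒m<n∨m≡n m≤1+n
... | inj₁ (s≤s m≤n) = dom-downward ptr (PointerSeq.down ptr n d) m≤n
... | inj₂ refl = d

pointer-≤ : ∀ {s n k} → PointerSeq s → s n ≡ just k → k ≤ n
pointer-≤ {n = zero} ptr eq = ≤-reflexive (just-injective (trans (sym eq) (PointerSeq.start ptr)))
pointer-≤ {n = suc n} ptr eq = <⇒≤ (PointerSeq.points ptr n _ eq)

unionOfIsolatedIntervals⇒isolated : ∀ {s I} → PointerSeq s →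
  UnionOfIsolatedIntervals s I → Isolated s I
unionOfIsolatedIntervals⇒isolated {s} {I} ptr (M , member , cover , covered) = in-dom , closed
  where
  in-dom : ∀ n → I n → Dom s n
  in-dom n In with cover n In
  ... | m , Mm , _ , _ , _ , n≤m = dom-downward ptr (proj₁ (member m Mm)) n≤m

  closed : ∀ n k → s n ≡ just k → I k → I n
  closed n k eq Ik with cover k Ik
  ... | m , Mm , k∈[p,m] = covered n m Mm (proj₂ (proj₂ (member m Mm)) n k eq k∈[p,m])

isolated-intervals-do-not-cross : ∀ {s m m′ p p′} → Isolated s (Interval s m) →
  s m ≡ just p → s m′ ≡ just p′ → p < p′ → p′ ≤ m → m ≤ m′ → ⊥
isolated-intervals-do-not-cross iso eq eq′ p<p′ p′≤m m≤m′
  with proj₂ iso _ _ eq′ (_ , eq , <⇒≤ p<p′ , p′≤m)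
... | _ , _ , _ , m′≤m with ≤-antisym m≤m′ m′≤m
... | refl = <-irrefl (just-injective (trans (sym eq) eq′)) p<p′

module Rank (em : ExcludedMiddle 0ℓ) (P : ℕ → Set) where

  rank : ℕ → ℕ
  rank zero = zero
  rank (suc x) with em {P x}
  ... | yes _ = suc (rank x)
  ... | no _ = rank x

  rank-suc : ∀ {x} → P x → rank (suc x) ≡ suc (rank x)
  rank-suc {x} Px with em {P x}
  ... | yes _ = refl
  ... | no ¬Px = contradiction Px ¬Px

  rank-step : ∀ x → rank x ≤ rank (suc x)
  rank-step x with em {P x}
  ... | yes _ = n≤1+n (rank x)
  ... | no _ = ≤-refl

  rank-mono : ∀ {m n} → m ≤ n → rank m ≤ rank n
  rank-mono {n = zero} z≤n = ≤-refl
  rank-mono {n = suc n} m≤1+n with m≤n⇒m<n∨m≡n m≤1+n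
  ... | inj₁ (s≤s m≤n) = ≤-trans (rank-mono m≤n) (rank-step n)
  ... | inj₂ refl = ≤-refl

  rank-strict : ∀ {x y} → P x → x < y → rank x < rank y
  rank-strict Px x<y = subst (_≤ _) (rank-suc Px) (rank-mono x<y)

  rank-injective : ∀ {x y} → P x → P y → rank x ≡ rank y → x ≡ y
  rank-injective {x} {y} Px Py r≡ with <-cmp x y
  ... | tri< x<y _ _ = contradiction r≡ (<⇒≢ (rank-strict Px x<y))
  ... | tri≈ _ x≡y _ = x≡y
  ... | tri> _ _ y<x = contradiction (sym r≡) (<⇒≢ (rank-strict Py y<x))

  rank-constant : ∀ {q x} → (∀ w → q ≤ w → w < x → ¬ P w) → q ≤ x → rank x ≡ rank q
  rank-constant {x = zero} none z≤n = refl
  rank-constant {x = suc x} none q≤1+x with m≤n⇒m<n∨m≡n q≤1+x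
  ... | inj₂ refl = refl
  ... | inj₁ (s≤s q≤x) with em {P x}
  ...   | yes Px = contradiction Px (none x q≤x ≤-refl)
  ...   | no _ = rank-constant (λ w q≤w w<x → none w q≤w (m<n⇒m<1+n w<x)) q≤x

  Ranked : ℕ → Set
  Ranked n = Σ ℕ λ x → P x × rank x ≡ n

  <rank⇒Ranked : ∀ {m} x → m < rank x → Ranked m
  <rank⇒Ranked (suc x) m<r with em {P x}
  ... | no _ = <rank⇒Ranked x m<r
  ... | yes Px with m<1+n⇒m<n∨m≡n m<r
  ...   | inj₁ m<rx = <rank⇒Ranked x m<rx
  ...   | inj₂ m≡rx = x , Px , sym m≡rx

  Ranked-downward : ∀ {m n} → m ≤ n → Ranked n → Ranked m
  Ranked-downward m≤n r@(x , _ , refl) with m≤n⇒m<n∨m≡n m≤n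
  ... | inj₁ m<n = <rank⇒Ranked x m<n
  ... | inj₂ refl = r

  select : ℕ → ℕ
  select n with em {Ranked n}
  ... | yes (x , _) = x
  ... | no _ = zero

  select-spec : ∀ {n} → Ranked n → P (select n) × rank (select n) ≡ n
  select-spec {n} r with em {Ranked n}
  ... | yes (_ , Px , rx) = Px , rx
  ... | no ¬r = contradiction r ¬r

  select-rank : ∀ {x} → P x → select (rank x) ≡ x
  select-rank Px =
    let P-sel , rank-sel = select-spec (_ , Px , refl) in rank-injective P-sel Px rank-sel

  select-increasing : ∀ {m n} → Ranked n → m < n → select m < select n
  select-increasing r m<n = ≰⇒> λ sel-n≤sel-m →
    <⇒≱ m<n (subst₂ _≤_ (proj₂ (select-spec r))
                        (proj₂ (select-spec (Ranked-downward (<⇒≤ m<n) r)))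
                        (rank-mono sel-n≤sel-m))

module Minus (em : ExcludedMiddle 0ℓ) {i : Seq} (ptr : PointerSeq i)
             {I : Subset} (iso : Isolated i I) where

  open PointerSeq ptr

  Kept : ℕ → Set
  Kept x = Dom i x × ¬ I x

  open Rank em Kept public

  kept-closed : ∀ {x k} → Kept x → i x ≡ just k → Kept k
  kept-closed (dom-x , x∉I) eq =
    dom-downward ptr dom-x (pointer-≤ ptr eq) , λ k∈I → x∉I (proj₂ iso _ _ eq k∈I)

  minus : Seq
  minus n with em {Ranked n}
  ... | yes (x , _) = Maybe.map rank (i x)
  ... | no _ = nothing

  minus-rank : ∀ {x k} → Kept x → i x ≡ just k → minus (rank x) ≡ just (rank k)
  minus-rank {x} Kx eq with em {Ranked (rank x)}
  ... | yes (x′ , Kx′ , same-rank) rewrite rank-injective Kx′ Kx same-rank | eq = refl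
  ... | no ¬r = contradiction (x , Kx , refl) ¬r

  minus-just : ∀ {n v} → minus n ≡ just v →
    Ranked n × Σ ℕ λ k → i (select n) ≡ just k × rank k ≡ v
  minus-just {n} eq with em {Ranked n}
  ... | no _ with () ← eq
  ... | yes r@(x , _) with i x | eq
  ...   | just k | refl = r , k , refl , refl

  Ranked⇒dom : ∀ {n} → Ranked n → Dom minus n
  Ranked⇒dom (x , Kx@((k , eq) , _) , refl) = rank k , minus-rank Kx eq

  dom⇒Ranked : ∀ {n} → Dom minus n → Ranked n
  dom⇒Ranked (_ , eq) = proj₁ (minus-just eq)

  minus-start : Σ ℕ Kept → minus 0 ≡ just 0
  minus-start (x , Kx) with Ranked-downward z≤n (x , Kx , refl)
  ... | y , Ky@((k , eq) , _) , rank-y≡0 = begin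
    minus 0             ≡⟨ cong minus (sym rank-y≡0) ⟩
    minus (rank y)      ≡⟨ minus-rank Ky eq ⟩
    just (rank k)       ≡⟨ cong just (n≤0⇒n≡0 (subst (rank k ≤_) rank-y≡0 (rank-mono (pointer-≤ ptr eq)))) ⟩
    just 0              ∎
    where open ≡-Reasoning

  rank-pointer-< : ∀ {x k} → Kept x → i x ≡ just k → 0 < rank x → rank k < rank x
  rank-pointer-< {suc x} Kx eq _ = rank-strict (kept-closed Kx eq) (points x _ eq)

  minus-pointer : Σ ℕ Kept → PointerSeq minus
  minus-pointer kept = record
    { down   = λ n d → Ranked⇒dom (Ranked-downward (n≤1+n n) (dom⇒Ranked d))
    ; start  = minus-start kept
    ; points = points′
    }
    where
    points′ : ∀ n v → minus (suc n) ≡ just v → v < suc n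
    points′ n v eq with minus-just eq
    ... | r , k , eq′ , refl with select-spec r
    ...   | K-sel , rank-sel =
      subst (rank k <_) rank-sel (rank-pointer-< K-sel eq′ (subst (0 <_) (sym rank-sel) z<s))

  nothing-kept⇒MinusEmpty : ¬ Σ ℕ Kept → MinusEmpty i I
  nothing-kept⇒MinusEmpty nothing-kept n dom-n with em {I n}
  ... | yes n∈I = n∈I
  ... | no n∉I = contradiction (n , dom-n , n∉I) nothing-kept

  minus-isMinus : Σ ℕ Kept → IsMinus i I minus
  minus-isMinus kept =
      minus-pointer kept
    , select
    , (λ m n d m<n → select-increasing (dom⇒Ranked d) m<n)
    , (λ n d → proj₁ (select-spec (dom⇒Ranked d)))
    , (λ x dom-x x∉I → rank x , Ranked⇒dom (x , (dom-x , x∉I) , refl) , select-rank (dom-x , x∉I))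
    , hom
    where
    hom : ∀ n v → minus n ≡ just v → i (select n) ≡ just (select v)
    hom n v eq with minus-just eq
    ... | r , k , eq′ , refl =
      trans eq′ (cong just (sym (select-rank (kept-closed (proj₁ (select-spec r)) eq′))))

module Gaps {s : Seq} {I : Subset} (U : UnionOfIsolatedIntervals s I) where

  private
    M = proj₁ U
    member = proj₁ (proj₂ U)
    cover = proj₁ (proj₂ (proj₂ U))
    covered = proj₂ (proj₂ (proj₂ U))

  CoveredGap : ℕ → ℕ → Set
  CoveredGap q x = q ≤ x × ∀ w → q ≤ w → w < x →
    Σ ℕ λ m → M m × Σ ℕ λ p → (s m ≡ just p × p ≤ w × w ≤ m) × q ≤ p

  gap-empty : ∀ {x} → CoveredGap x x
  gap-empty = ≤-refl , λ w x≤w w<x → contradiction w<x (≤⇒≯ x≤w)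

  gap-⊆ : ∀ {q x w} → CoveredGap q x → q ≤ w → w < x → I w
  gap-⊆ (_ , gap) q≤w w<x with gap _ q≤w w<x
  ... | m , Mm , p , w∈[p,m] , _ = covered _ m Mm (p , w∈[p,m])

  gap-extend : ∀ {q x p} → M q → s q ≡ just p → p ≤ q → CoveredGap (suc q) x → CoveredGap p x
  gap-extend {q} {x} {p} Mq eq p≤q (q<x , gap) = ≤-trans p≤q (<⇒≤ q<x) , gap′
    where
    gap′ : ∀ w → p ≤ w → w < x →
      Σ ℕ λ m → M m × Σ ℕ λ p′ → (s m ≡ just p′ × p′ ≤ w × w ≤ m) × p ≤ p′
    gap′ w p≤w w<x with w ≤? q
    ... | yes w≤q = q , Mq , p , (eq , p≤w , w≤q) , ≤-refl
    ... | no w≰q with gap w (≰⇒> w≰q) w<x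
    ...   | m , Mm , p′ , w∈[p′,m] , q<p′ = m , Mm , p′ , w∈[p′,m] , ≤-trans p≤q (<⇒≤ q<p′)

  -- The interval [p, m] ∋ q must end at q: otherwise m < x (as x ∉ I), and the
  -- interval covering m inside the gap would cross [p, m].
  gap-step : ∀ {q x} → ¬ I x → CoveredGap (suc q) x → I q →
    Σ ℕ λ p → s q ≡ just p × CoveredGap p x
  gap-step {q} {x} x∉I g@(q<x , gap) q∈I with cover q q∈I
  ... | m , Mm , p , eq , p≤q , q≤m with m≤n⇒m<n∨m≡n q≤m
  ...   | inj₂ refl = p , eq , gap-extend Mm eq p≤q g
  ...   | inj₁ q<m with x ≤? m
  ...     | yes x≤m = contradiction (covered x m Mm (p , eq , ≤-trans p≤q (<⇒≤ q<x) , x≤m)) x∉I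
  ...     | no x≰m with gap m q<m (≰⇒> x≰m)
  ...       | m′ , _ , p′ , (eq′ , p′≤m , m≤m′) , q<p′ =
    ⊥-elim (isolated-intervals-do-not-cross (proj₂ (member m Mm)) eq eq′
              (≤-<-trans p≤q q<p′) p′≤m m≤m′)

module MinusInteraction (em : ExcludedMiddle 0ℓ) {i : Seq} (ii : Interaction i)
                        {I : Subset} (U : UnionOfIsolatedIntervals i I) where

  open Interaction ii

  isolated : Isolated i I
  isolated = unionOfIsolatedIntervals⇒isolated pointer U

  open Minus em pointer isolated public
  open Gaps U

  rank-below-gap : ∀ {q x} → Kept q → CoveredGap (suc q) x → rank x ≡ suc (rank q)
  rank-below-gap Kq g@(q<x , _) =
    trans (rank-constant (λ w q<w w<x Kw → proj₂ Kw (gap-⊆ g q<w w<x)) q<x) (rank-suc Kq)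

  V-minus : ∀ {x q a} → Kept x → CoveredGap q x → Kept a → V i q a → V minus (rank x) (rank a)
  V-minus Kx g Ka here = subst (λ r → V minus r _) (sym (rank-below-gap Ka g)) here
  V-minus {x} Kx g@(q<x , _) Ka (there {n = q} eq v) with em {I q}
  ... | yes q∈I with gap-step (proj₂ Kx) g q∈I
  ...   | p , eq′ , g′ =
    V-minus Kx (subst (λ r → CoveredGap r x) (just-injective (trans (sym eq′) eq)) g′) Ka v
  V-minus {x} Kx g@(q<x , _) Ka (there {n = q} eq v) | no q∉I =
    subst (λ r → V minus r _) (sym (rank-below-gap Kq g))
      (there (minus-rank Kq eq) (V-minus (kept-closed Kq eq) gap-empty Ka v))
    where
    Kq : Kept q
    Kq = dom-downward pointer (proj₁ Kx) (<⇒≤ q<x) , q∉I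

  V-minus-pointer : ∀ {x k} → Kept x → i x ≡ just k → 0 < rank x → V minus (rank x) (rank k)
  V-minus-pointer {suc x} Kx eq _ = V-minus Kx gap-empty (kept-closed Kx eq) (inV x _ eq)

  minus-interaction : Σ ℕ Kept → Interaction minus
  minus-interaction kept = record { pointer = minus-pointer kept ; inV = inV′ }
    where
    inV′ : ∀ n v → minus (suc n) ≡ just v → V minus (suc n) v
    inV′ n v eq with minus-just eq
    ... | r , k , eq′ , refl with select-spec r
    ...   | K-sel , rank-sel =
      subst (λ r → V minus r (rank k)) rank-sel
        (V-minus-pointer K-sel eq′ (subst (0 <_) (sym rank-sel) z<s))

  minus-empty-or-interaction : MinusEmpty i I ⊎ Σ Seq λ j → IsMinus i I j × Interaction j
  minus-empty-or-interaction with em {Σ ℕ Kept}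
  ... | yes kept = inj₂ (minus , minus-isMinus kept , minus-interaction kept)
  ... | no nothing-kept = inj₁ (nothing-kept⇒MinusEmpty nothing-kept)

mainTheorem9 : ExcludedMiddle 0ℓ → (i : Seq) → Interaction i → (I : Subset) →
    UnionOfIsolatedIntervals i I →
    Isolated i I × (MinusEmpty i I ⊎ Σ Seq λ j → IsMinus i I j × Interaction j)
mainTheorem9 em i ii I U = isolated , minus-empty-or-interaction
  where open MinusInteraction em ii U
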